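{- Let $a,b$ be nonnegative integers and $n\ge 1$. Then $$\det\left[\binom{2i+2a}{j+b}\right]_{i,j=0}^{n-1}=2^{\binom{n}{2}}\prod_{i=0}^{n-1}\binom{2i+2a}{b}\binom{i+b}{b}^{ -1}.$$
   Context: Binomial coefficients follow the convention $\binom{m}{k}=0$ if $k<0$ or $k>m$. -}

module Defs where

open import Data.Nat using (ℕ; zero; suc; _+_; NonZero)
open import Data.Nat.Combinatorics using (_C_; nCn≡1; nCk+nC[k+1]≡[n+1]C[k+1])
open import Data.Fin using (Fin; zero; suc; punchIn; toℕ)
open import Data.Integer using (ℤ; +_; -_)
import Data.Integer as ℤ
open import Data.Rational using (ℚ; 1ℚ)
import Data.Rational as ℚ
open import Relation.Binary.PropositionalEquality using (sym; subst)

sumFin : (n : ℕ) → (Fin n → ℤ) → ℤ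
sumFin zero    f = + 0
sumFin (suc n) f = f zero ℤ.+ sumFin n (λ j → f (suc j))

sign : ℕ → ℤ
sign zero    = + 1
sign (suc k) = - sign k

-- Determinant of an n×n integer matrix (Laplace expansion along the first row;
-- agrees with the Leibniz formula).
det : (n : ℕ) → (Fin n → Fin n → ℤ) → ℤ
det zero    M = + 1
det (suc n) M =
  sumFin (suc n) (λ j → sign (toℕ j) ℤ.* (M zero j ℤ.* det n (λ r c → M (suc r) (punchIn j c))))

prodℚ : (n : ℕ) → (ℕ → ℚ) → ℚ
prodℚ zero    f = 1ℚ
prodℚ (suc n) f = prodℚ n f ℚ.* f n

private
  nz+ : ∀ x y → NonZero y → NonZero (x + y)
  nz+ zero    y p = p
  nz+ (suc x) y p = _

binom-nonZero : ∀ m k → NonZero ((m + k) C k)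
binom-nonZero m zero = _
binom-nonZero zero (suc k) = subst NonZero (sym (nCn≡1 (suc k))) _
binom-nonZero (suc m) (suc k) =
  subst NonZero (nCk+nC[k+1]≡[n+1]C[k+1] (m + suc k) k)
    (nz+ ((m + suc k) C k) _ (binom-nonZero m (suc k)))

invBinom : ℕ → ℕ → ℚ
invBinom i b = ((+ 1) ℚ./ ((i + b) C b)) {{binom-nonZero i b}}

ℕtoℚ : ℕ → ℚ
ℕtoℚ x = (+ x) ℚ./ 1

module Submission where

-- Clearing denominators, the identity reads
--   ∏ⱼ C(j+b,b) · det[C(2i+2a, j+b)] = ∏ᵢ C(2i+2a,b) · 2^C(n,2).
-- Scaling column j by C(j+b,b) and using C(x,j+b) C(j+b,b) = C(x,b) C(x-b,j) turns the left side into
-- ∏ᵢ C(xᵢ,b) · det[C(xᵢ-b, j)] with xᵢ = 2i+2a. If b > 2a the factor C(2a,b) of row 0 vanishes. Otherwise note that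
-- det[C(xᵢ, j)] is unchanged when every xᵢ grows by one: by Pascal's rule, C(xᵢ+1, j) arises from
-- C(xᵢ, j) by adding column j-1 to column j, done from the last column down. Hence the determinant
-- equals g(n) = det[C(2i, j)]. Its first row is (1, 0, …, 0), which leaves det[C(2i+2, j+1)]; the same
-- factorisation with b = 1 pulls out ∏ (2i+2) / ∏ (j+1) = 2ⁿ and leaves det[C(2i+1, j)] = g(n).
-- So g(n+1) = 2ⁿ g(n), i.e. g(n) = 2^C(n,2).

open import Data.Fin using (Fin; zero; suc; toℕ; inject₁; punchIn; punchOut; _≟_)
open import Data.Fin.Properties
  using (suc-injective; toℕ-inject₁; punchIn-injective; punchInᵢ≢i; punchIn-punchOut)
open import Data.Product using (Σ; _×_; _,_)
open import Data.Empty using (⊥-elim)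
open import Relation.Nullary using (yes; no)
open import Relation.Binary.PropositionalEquality
open import Defs

module Determinant where

  open import Data.Nat using (ℕ; zero; suc)
  open import Data.Integer using (ℤ; 0ℤ; 1ℤ; _+_; _*_; -_; NonZero)
  import Data.Integer.Properties as ℤ
  open import Data.Integer.Tactic.RingSolver using (solve-∀)
  open import Data.Vec.Functional using (Vector; removeAt)
  open import Algebra.Properties.Semiring.Sum ℤ.+-*-semiring
    using (sum; sum-cong-≗; sum-replicate-zero; ∑-distrib-+; *-distribˡ-sum)
  open import Algebra.Properties.CommutativeMonoid.Sum ℤ.*-1-commutativeMonoid
    using () renaming (sum to product; sum-cong-≗ to ∏-cong; sum-remove to ∏-remove;
                       ∑-distrib-+ to ∏-distrib-*)
    public
  open ≡-Reasoning

  ∏ : ∀ n → Vector ℤ n → ℤ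
  ∏ n = product

  Matrix : ℕ → Set
  Matrix n = Fin n → Fin n → ℤ

  minor : ∀ {n} → Matrix (suc n) → Fin (suc n) → Matrix n
  minor M j r c = M (suc r) (punchIn j c)

  cofactorTerm : ∀ {n} → Matrix (suc n) → Fin (suc n) → ℤ
  cofactorTerm {n} M j = sign (toℕ j) * (M zero j * det n (minor M j))

  sumFin≡sum : ∀ n (f : Vector ℤ n) → sumFin n f ≡ sum f
  sumFin≡sum zero    f = refl
  sumFin≡sum (suc n) f = cong (f zero +_) (sumFin≡sum n (λ j → f (suc j)))

  det-expand : ∀ {n} (M : Matrix (suc n)) → det (suc n) M ≡ sum (cofactorTerm M)
  det-expand {n} M = sumFin≡sum (suc n) (cofactorTerm M)

  sum-zero : ∀ {n} (f : Vector ℤ n) → (∀ j → f j ≡ 0ℤ) → sum f ≡ 0ℤ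
  sum-zero {n} f f≡0 = trans (sum-cong-≗ f≡0) (sum-replicate-zero n)

  det-cong : ∀ n {M N : Matrix n} → (∀ i j → M i j ≡ N i j) → det n M ≡ det n N
  det-cong zero    M≡N = refl
  det-cong (suc n) {M} {N} M≡N = begin
    det (suc n) M        ≡⟨ det-expand M ⟩
    sum (cofactorTerm M) ≡⟨ sum-cong-≗ term≡ ⟩
    sum (cofactorTerm N) ≡⟨ det-expand N ⟨
    det (suc n) N        ∎
    where
    term≡ : ∀ j → cofactorTerm M j ≡ cofactorTerm N j
    term≡ j = cong (sign (toℕ j) *_)
      (cong₂ _*_ (M≡N zero j) (det-cong n (λ r c → M≡N (suc r) (punchIn j c))))

  det-scaleRows : ∀ n (r : Vector ℤ n) (M : Matrix n) →
    det n (λ i j → r i * M i j) ≡ ∏ n r * det n M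
  det-scaleRows zero    r M = refl
  det-scaleRows (suc n) r M = begin
    det (suc n) (λ i j → r i * M i j)
      ≡⟨ det-expand (λ i j → r i * M i j) ⟩
    sum (λ j → sign (toℕ j) * ((r zero * M zero j) * det n (λ a c → r (suc a) * minor M j a c)))
      ≡⟨ sum-cong-≗ (λ j → cong (λ d → sign (toℕ j) * ((r zero * M zero j) * d))
                                (det-scaleRows n (λ a → r (suc a)) (minor M j))) ⟩
    sum (λ j → sign (toℕ j) * ((r zero * M zero j) * (∏ n (λ a → r (suc a)) * det n (minor M j))))
      ≡⟨ sum-cong-≗ (λ j → regroup (sign (toℕ j)) (r zero) (M zero j)
                                   (∏ n (λ a → r (suc a))) (det n (minor M j))) ⟩
    sum (λ j → ∏ (suc n) r * cofactorTerm M j)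
      ≡⟨ *-distribˡ-sum (∏ (suc n) r) (cofactorTerm M) ⟨
    ∏ (suc n) r * sum (cofactorTerm M)
      ≡⟨ cong (∏ (suc n) r *_) (det-expand M) ⟨
    ∏ (suc n) r * det (suc n) M ∎
    where
    regroup : ∀ s a m p d → s * ((a * m) * (p * d)) ≡ (a * p) * (s * (m * d))
    regroup = solve-∀

  det-scaleColumns : ∀ n (c : Vector ℤ n) (M : Matrix n) →
    det n (λ i j → M i j * c j) ≡ ∏ n c * det n M
  det-scaleColumns zero    c M = refl
  det-scaleColumns (suc n) c M = begin
    det (suc n) (λ i j → M i j * c j)
      ≡⟨ det-expand (λ i j → M i j * c j) ⟩
    sum (λ j → sign (toℕ j) * ((M zero j * c j) * det n (λ a k → minor M j a k * removeAt c j k)))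
      ≡⟨ sum-cong-≗ (λ j → cong (λ d → sign (toℕ j) * ((M zero j * c j) * d))
                                (det-scaleColumns n (removeAt c j) (minor M j))) ⟩
    sum (λ j → sign (toℕ j) * ((M zero j * c j) * (∏ n (removeAt c j) * det n (minor M j))))
      ≡⟨ sum-cong-≗ (λ j → trans (regroup (sign (toℕ j)) (M zero j) (c j)
                                          (∏ n (removeAt c j)) (det n (minor M j)))
                                 (cong (_* cofactorTerm M j) (sym (∏-remove {i = j} c)))) ⟩
    sum (λ j → ∏ (suc n) c * cofactorTerm M j)
      ≡⟨ *-distribˡ-sum (∏ (suc n) c) (cofactorTerm M) ⟨
    ∏ (suc n) c * sum (cofactorTerm M)
      ≡⟨ cong (∏ (suc n) c *_) (det-expand M) ⟨
    ∏ (suc n) c * det (suc n) M ∎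
    where
    regroup : ∀ s m x p d → s * ((m * x) * (p * d)) ≡ (x * p) * (s * (m * d))
    regroup = solve-∀

  punchIn-≢-punchOut : ∀ {n} {i j : Fin (suc n)} (i≢j : i ≢ j) {k : Fin n} →
    k ≢ punchOut i≢j → punchIn i k ≢ j
  punchIn-≢-punchOut {i = i} i≢j {k} k≢ eq =
    k≢ (punchIn-injective i k _ (trans eq (sym (punchIn-punchOut i≢j))))

  det-linear-column : ∀ n (q : Fin n) (t : ℤ) (A B C : Matrix n) →
    (∀ i j → j ≢ q → A i j ≡ B i j) → (∀ i j → j ≢ q → A i j ≡ C i j) →
    (∀ i → A i q ≡ B i q + t * C i q) → det n A ≡ det n B + t * det n C
  det-linear-column (suc n) q t A B C A≡B A≡C A≡B+tC = begin
    det (suc n) A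
      ≡⟨ det-expand A ⟩
    sum (cofactorTerm A)
      ≡⟨ sum-cong-≗ term≡ ⟩
    sum (λ j → cofactorTerm B j + t * cofactorTerm C j)
      ≡⟨ ∑-distrib-+ (cofactorTerm B) (λ j → t * cofactorTerm C j) ⟩
    sum (cofactorTerm B) + sum (λ j → t * cofactorTerm C j)
      ≡⟨ cong (sum (cofactorTerm B) +_) (*-distribˡ-sum t (cofactorTerm C)) ⟨
    sum (cofactorTerm B) + t * sum (cofactorTerm C)
      ≡⟨ cong₂ (λ x y → x + t * y) (det-expand B) (det-expand C) ⟨
    det (suc n) B + t * det (suc n) C ∎
    where
    expand-entry : ∀ s t b c d → s * ((b + t * c) * d) ≡ s * (b * d) + t * (s * (c * d))
    expand-entry = solve-∀
    expand-minor : ∀ s t a d e → s * (a * (d + t * e)) ≡ s * (a * d) + t * (s * (a * e))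
    expand-minor = solve-∀
    term≡ : ∀ j → cofactorTerm A j ≡ cofactorTerm B j + t * cofactorTerm C j
    term≡ j with j ≟ q
    ... | yes refl = begin
      sign (toℕ j) * (A zero j * det n (minor A j))
        ≡⟨ cong (λ a → sign (toℕ j) * (a * det n (minor A j))) (A≡B+tC zero) ⟩
      sign (toℕ j) * ((B zero j + t * C zero j) * det n (minor A j))
        ≡⟨ expand-entry (sign (toℕ j)) t (B zero j) (C zero j) (det n (minor A j)) ⟩
      sign (toℕ j) * (B zero j * det n (minor A j)) + t * (sign (toℕ j) * (C zero j * det n (minor A j)))
        ≡⟨ cong₂ (λ x y → sign (toℕ j) * (B zero j * x) + t * (sign (toℕ j) * (C zero j * y)))
             (det-cong n (λ r c → A≡B (suc r) (punchIn j c) (punchInᵢ≢i j c)))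
             (det-cong n (λ r c → A≡C (suc r) (punchIn j c) (punchInᵢ≢i j c))) ⟩
      cofactorTerm B j + t * cofactorTerm C j ∎
    ... | no j≢q = begin
      sign (toℕ j) * (A zero j * det n (minor A j))
        ≡⟨ cong (λ d → sign (toℕ j) * (A zero j * d)) minor-linear ⟩
      sign (toℕ j) * (A zero j * (det n (minor B j) + t * det n (minor C j)))
        ≡⟨ expand-minor (sign (toℕ j)) t (A zero j) (det n (minor B j)) (det n (minor C j)) ⟩
      sign (toℕ j) * (A zero j * det n (minor B j)) + t * (sign (toℕ j) * (A zero j * det n (minor C j)))
        ≡⟨ cong₂ (λ x y → sign (toℕ j) * (x * det n (minor B j))
                          + t * (sign (toℕ j) * (y * det n (minor C j))))
             (A≡B zero j j≢q) (A≡C zero j j≢q) ⟩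
      cofactorTerm B j + t * cofactorTerm C j ∎
      where
      minor-linear : det n (minor A j) ≡ det n (minor B j) + t * det n (minor C j)
      minor-linear = det-linear-column n (punchOut j≢q) t (minor A j) (minor B j) (minor C j)
        (λ r c c≢q′ → A≡B (suc r) (punchIn j c) (punchIn-≢-punchOut j≢q c≢q′))
        (λ r c c≢q′ → A≡C (suc r) (punchIn j c) (punchIn-≢-punchOut j≢q c≢q′))
        (λ r → subst (λ k → A (suc r) k ≡ B (suc r) k + t * C (suc r) k)
                     (sym (punchIn-punchOut j≢q)) (A≡B+tC (suc r)))

  punchIn-adjacent-swap : ∀ {a} {X : Set a} {n} (f : Fin (suc n) → X) (p : Fin n) →
    f (inject₁ p) ≡ f (suc p) → ∀ c → f (punchIn (inject₁ p) c) ≡ f (punchIn (suc p) c)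
  punchIn-adjacent-swap f zero    eq zero    = sym eq
  punchIn-adjacent-swap f zero    eq (suc c) = refl
  punchIn-adjacent-swap f (suc p) eq zero    = refl
  punchIn-adjacent-swap f (suc p) eq (suc c) = punchIn-adjacent-swap (λ k → f (suc k)) p eq c

  punchOut-adjacent : ∀ {n} (j : Fin (suc (suc n))) (p : Fin (suc n)) → j ≢ inject₁ p → j ≢ suc p →
    Σ (Fin n) λ p′ → punchIn j (inject₁ p′) ≡ inject₁ p × punchIn j (suc p′) ≡ suc p
  punchOut-adjacent         zero          zero    j≢p j≢p+1 = ⊥-elim (j≢p refl)
  punchOut-adjacent         zero          (suc p) j≢p j≢p+1 = p , refl , refl
  punchOut-adjacent         (suc zero)    zero    j≢p j≢p+1 = ⊥-elim (j≢p+1 refl)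
  punchOut-adjacent {suc n} (suc (suc j)) zero    j≢p j≢p+1 = zero , refl , refl
  punchOut-adjacent {suc n} (suc j)       (suc p) j≢p j≢p+1
    with punchOut-adjacent j p (λ eq → j≢p (cong suc eq)) (λ eq → j≢p+1 (cong suc eq))
  ... | p′ , eq₁ , eq₂ = suc p′ , cong suc eq₁ , cong suc eq₂

  sum-cancel-adjacent : ∀ {n} (f : Vector ℤ (suc n)) (p : Fin n) →
    (∀ j → j ≢ inject₁ p → j ≢ suc p → f j ≡ 0ℤ) → f (inject₁ p) + f (suc p) ≡ 0ℤ →
    sum f ≡ 0ℤ
  sum-cancel-adjacent {suc n} f zero others pair = begin
    f zero + (f (suc zero) + sum (λ j → f (suc (suc j))))
      ≡⟨ cong (λ s → f zero + (f (suc zero) + s))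
              (sum-zero _ (λ j → others (suc (suc j)) (λ ()) (λ ()))) ⟩
    f zero + (f (suc zero) + 0ℤ)
      ≡⟨ cong (f zero +_) (ℤ.+-identityʳ (f (suc zero))) ⟩
    f zero + f (suc zero)
      ≡⟨ pair ⟩
    0ℤ ∎
  sum-cancel-adjacent {suc n} f (suc p) others pair =
    cong₂ _+_ (others zero (λ ()) (λ ()))
      (sum-cancel-adjacent (λ j → f (suc j)) p
        (λ j j≢p j≢p+1 → others (suc j) (λ eq → j≢p (suc-injective eq))
                                         (λ eq → j≢p+1 (suc-injective eq)))
        pair)

  det-adjacent-columns-equal : ∀ n (A : Matrix (suc n)) (p : Fin n) →
    (∀ i → A i (inject₁ p) ≡ A i (suc p)) → det (suc n) A ≡ 0ℤ
  det-adjacent-columns-equal (suc n) A p columns≡ =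
    trans (det-expand A) (sum-cancel-adjacent (cofactorTerm A) p others pair)
    where
    others : ∀ j → j ≢ inject₁ p → j ≢ suc p → cofactorTerm A j ≡ 0ℤ
    others j j≢p j≢p+1 with punchOut-adjacent j p j≢p j≢p+1
    ... | p′ , eq₁ , eq₂ = begin
      sign (toℕ j) * (A zero j * det (suc n) (minor A j))
        ≡⟨ cong (λ d → sign (toℕ j) * (A zero j * d)) (det-adjacent-columns-equal n (minor A j) p′
             (λ r → trans (cong (A (suc r)) eq₁)
                          (trans (columns≡ (suc r)) (cong (A (suc r)) (sym eq₂))))) ⟩
      sign (toℕ j) * (A zero j * 0ℤ)  ≡⟨ cong (sign (toℕ j) *_) (ℤ.*-zeroʳ (A zero j)) ⟩
      sign (toℕ j) * 0ℤ               ≡⟨ ℤ.*-zeroʳ (sign (toℕ j)) ⟩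
      0ℤ                              ∎
    d : ℤ
    d = det (suc n) (minor A (inject₁ p))
    cancel : ∀ s x → s * x + - s * x ≡ 0ℤ
    cancel = solve-∀
    pair : cofactorTerm A (inject₁ p) + cofactorTerm A (suc p) ≡ 0ℤ
    pair = begin
      sign (toℕ (inject₁ p)) * (A zero (inject₁ p) * d)
        + - sign (toℕ p) * (A zero (suc p) * det (suc n) (minor A (suc p)))
        ≡⟨ cong₂ (λ s m → s * (A zero (inject₁ p) * d) + - sign (toℕ p) * m)
             (cong sign (toℕ-inject₁ p))
             (cong₂ _*_ (sym (columns≡ zero)) (det-cong (suc n) (λ r c →
                sym (punchIn-adjacent-swap (A (suc r)) p (columns≡ (suc r)) c)))) ⟩
      sign (toℕ p) * (A zero (inject₁ p) * d) + - sign (toℕ p) * (A zero (inject₁ p) * d)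
        ≡⟨ cancel (sign (toℕ p)) (A zero (inject₁ p) * d) ⟩
      0ℤ ∎

  inject₁≢suc : ∀ {n} (k : Fin n) → inject₁ k ≢ suc k
  inject₁≢suc zero    ()
  inject₁≢suc (suc k) eq = inject₁≢suc k (suc-injective eq)

  det-add-previous-column : ∀ n (t : ℤ) (p : Fin n) (A B : Matrix (suc n)) →
    (∀ i j → j ≢ suc p → B i j ≡ A i j) →
    (∀ i → B i (suc p) ≡ A i (suc p) + t * A i (inject₁ p)) →
    det (suc n) B ≡ det (suc n) A
  det-add-previous-column n t p A B B≡A B≡A+tA = begin
    det (suc n) B
      ≡⟨ det-linear-column (suc n) (suc p) t B A A′ B≡A
           (λ i j j≢q → trans (B≡A i j j≢q) (sym (A′-other i j j≢q)))
           (λ i → trans (B≡A+tA i) (cong (λ x → A i (suc p) + t * x) (sym (A′-at i)))) ⟩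
    det (suc n) A + t * det (suc n) A′
      ≡⟨ cong (λ x → det (suc n) A + t * x) (det-adjacent-columns-equal n A′ p
           (λ i → trans (A′-other i (inject₁ p) (inject₁≢suc p)) (sym (A′-at i)))) ⟩
    det (suc n) A + t * 0ℤ          ≡⟨ cong (det (suc n) A +_) (ℤ.*-zeroʳ t) ⟩
    det (suc n) A + 0ℤ              ≡⟨ ℤ.+-identityʳ (det (suc n) A) ⟩
    det (suc n) A                   ∎
    where
    copyPrevious : Fin (suc n) → Fin (suc n)
    copyPrevious j with j ≟ suc p
    ... | yes _ = inject₁ p
    ... | no  _ = j
    A′ : Matrix (suc n)
    A′ i j = A i (copyPrevious j)
    A′-at : ∀ i → A′ i (suc p) ≡ A i (inject₁ p)
    A′-at i with suc p ≟ suc p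
    ... | yes _       = refl
    ... | no  p+1≢p+1 = ⊥-elim (p+1≢p+1 refl)
    A′-other : ∀ i j → j ≢ suc p → A′ i j ≡ A i j
    A′-other i j j≢q with j ≟ suc p
    ... | yes j≡q = ⊥-elim (j≢q j≡q)
    ... | no  _   = refl

  det-firstRow-sparse : ∀ n (M : Matrix (suc n)) → (∀ j → M zero (suc j) ≡ 0ℤ) →
    det (suc n) M ≡ M zero zero * det n (λ r c → M (suc r) (suc c))
  det-firstRow-sparse n M row≡0 = begin
    det (suc n) M
      ≡⟨ det-expand M ⟩
    1ℤ * (M zero zero * det n (minor M zero)) + sum (λ j → cofactorTerm M (suc j))
      ≡⟨ cong₂ _+_ (ℤ.*-identityˡ (M zero zero * det n (minor M zero))) (sum-zero _ vanish) ⟩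
    M zero zero * det n (minor M zero) + 0ℤ
      ≡⟨ ℤ.+-identityʳ (M zero zero * det n (minor M zero)) ⟩
    M zero zero * det n (λ r c → M (suc r) (suc c)) ∎
    where
    vanish : ∀ j → cofactorTerm M (suc j) ≡ 0ℤ
    vanish j = begin
      sign (toℕ (suc j)) * (M zero (suc j) * det n (minor M (suc j)))
        ≡⟨ cong (λ x → sign (toℕ (suc j)) * (x * det n (minor M (suc j)))) (row≡0 j) ⟩
      sign (toℕ (suc j)) * 0ℤ
        ≡⟨ ℤ.*-zeroʳ (sign (toℕ (suc j))) ⟩
      0ℤ ∎

  ∏-nonZero : ∀ n (f : Vector ℤ n) → (∀ j → NonZero (f j)) → NonZero (∏ n f)
  ∏-nonZero zero    f nz = _
  ∏-nonZero (suc n) f nz = ℤ.i*j≢0 (f zero) (∏ n (λ j → f (suc j)))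
    {{nz zero}} {{∏-nonZero n (λ j → f (suc j)) (λ j → nz (suc j))}}

module Binomial where

  open import Data.Nat
  open import Data.Nat.Properties
  open import Data.Nat.Combinatorics using (_C_; nC1≡n; k>n⇒nCk≡0; nCk+nC[k+1]≡[n+1]C[k+1])
  open import Data.Nat.Tactic.RingSolver using (solve-∀)
  open import Algebra.Properties.CommutativeSemigroup *-commutativeSemigroup using (x∙yz≈y∙xz)
  open ≡-Reasoning

  [k+1]*[n+1]C[k+1]≡[n+1]*nCk : ∀ n k → suc k * (suc n C suc k) ≡ suc n * (n C k)
  [k+1]*[n+1]C[k+1]≡[n+1]*nCk n zero =
    trans (*-identityˡ (suc n C 1)) (trans (nC1≡n (suc n)) (sym (*-identityʳ (suc n))))
  [k+1]*[n+1]C[k+1]≡[n+1]*nCk zero (suc k) =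
    trans (cong (suc (suc k) *_) (k>n⇒nCk≡0 {1} {suc (suc k)} (s<s z<s))) (*-zeroʳ (suc (suc k)))
  [k+1]*[n+1]C[k+1]≡[n+1]*nCk (suc n) (suc k) = begin
    suc K * (suc N C suc K)
      ≡⟨ cong (suc K *_) (nCk+nC[k+1]≡[n+1]C[k+1] N K) ⟨
    suc K * (N C K + N C suc K)
      ≡⟨ spread k (N C K) (N C suc K) ⟩
    N C K + (K * (N C K) + suc K * (N C suc K))
      ≡⟨ cong₂ (λ x y → N C K + (x + y)) ([k+1]*[n+1]C[k+1]≡[n+1]*nCk n k)
                                         ([k+1]*[n+1]C[k+1]≡[n+1]*nCk n K) ⟩
    N C K + (N * (n C k) + N * (n C K))
      ≡⟨ cong (N C K +_) (*-distribˡ-+ N (n C k) (n C K)) ⟨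
    N C K + N * (n C k + n C K)
      ≡⟨ cong (λ x → N C K + N * x) (nCk+nC[k+1]≡[n+1]C[k+1] n k) ⟩
    suc N * (N C K) ∎
    where
    N K : ℕ
    N = suc n
    K = suc k
    spread : ∀ k x y → suc (suc k) * (x + y) ≡ x + (suc k * x + suc (suc k) * y)
    spread = solve-∀

  xC[j+s]*[j+s]Cs≡xCs*[x∸s]Cj : ∀ x s j → (x C (j + s)) * ((j + s) C s) ≡ (x C s) * ((x ∸ s) C j)
  xC[j+s]*[j+s]Cs≡xCs*[x∸s]Cj x zero j =
    trans (*-identityʳ (x C (j + 0))) (trans (cong (x C_) (+-identityʳ j)) (sym (*-identityˡ (x C j))))
  xC[j+s]*[j+s]Cs≡xCs*[x∸s]Cj zero (suc s) j rewrite +-suc j s = refl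
  xC[j+s]*[j+s]Cs≡xCs*[x∸s]Cj (suc x) (suc s) j rewrite +-suc j s = *-cancelˡ-≡ _ _ (suc s) (begin
    suc s * (X * M)                   ≡⟨ x∙yz≈y∙xz (suc s) X M ⟩
    X * (suc s * M)                   ≡⟨ cong (X *_) ([k+1]*[n+1]C[k+1]≡[n+1]*nCk m s) ⟩
    X * (suc m * (m C s))             ≡⟨ x∙yz≈y∙xz X (suc m) (m C s) ⟩
    suc m * (X * (m C s))             ≡⟨ *-assoc (suc m) X (m C s) ⟨
    suc m * X * (m C s)               ≡⟨ cong (_* (m C s)) ([k+1]*[n+1]C[k+1]≡[n+1]*nCk x m) ⟩
    suc x * (x C m) * (m C s)         ≡⟨ *-assoc (suc x) (x C m) (m C s) ⟩
    suc x * ((x C m) * (m C s))       ≡⟨ cong (suc x *_) (xC[j+s]*[j+s]Cs≡xCs*[x∸s]Cj x s j) ⟩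
    suc x * ((x C s) * R)             ≡⟨ *-assoc (suc x) (x C s) R ⟨
    suc x * (x C s) * R               ≡⟨ cong (_* R) ([k+1]*[n+1]C[k+1]≡[n+1]*nCk x s) ⟨
    suc s * (suc x C suc s) * R       ≡⟨ *-assoc (suc s) (suc x C suc s) R ⟩
    suc s * ((suc x C suc s) * R)     ∎)
    where
    m X M R : ℕ
    m = j + s
    X = suc x C suc m
    M = suc m C suc s
    R = (x ∸ s) C j

module BinomialDeterminant where

  open Determinant
  open Binomial
  open import Data.Nat
  open import Data.Nat.Properties
  open import Data.Nat.Combinatorics using (_C_; nC1≡n; k>n⇒nCk≡0; nCk+nC[k+1]≡[n+1]C[k+1])
  open import Data.Fin using (fromℕ<)
  open import Data.Fin.Properties using (toℕ-injective; toℕ-fromℕ<; toℕ<n)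
  open import Data.Integer as ℤ using (ℤ; +_; 0ℤ; 1ℤ)
  import Data.Integer.Properties as ℤ
  open import Relation.Nullary using (Dec)
  open ≡-Reasoning

  oneIf≤ : ℕ → ℕ → ℕ
  oneIf≤ zero    j       = 1
  oneIf≤ (suc m) zero    = 0
  oneIf≤ (suc m) (suc j) = oneIf≤ m j

  oneIf≤-< : ∀ {m j} → j < m → oneIf≤ m j ≡ 0
  oneIf≤-< {suc m} {zero}  j<m       = refl
  oneIf≤-< {suc m} {suc j} (s<s j<m) = oneIf≤-< j<m

  oneIf≤-refl : ∀ m → oneIf≤ m m ≡ 1
  oneIf≤-refl zero    = refl
  oneIf≤-refl (suc m) = oneIf≤-refl m

  oneIf≤-≢ : ∀ m j → j ≢ m → oneIf≤ (suc m) j ≡ oneIf≤ m j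
  oneIf≤-≢ zero    zero    j≢m = ⊥-elim (j≢m refl)
  oneIf≤-≢ zero    (suc j) j≢m = refl
  oneIf≤-≢ (suc m) zero    j≢m = refl
  oneIf≤-≢ (suc m) (suc j) j≢m = oneIf≤-≢ m j (λ eq → j≢m (cong suc eq))

  binomials : ∀ {n} → (Fin n → ℕ) → Matrix n
  binomials x i j = + (x i C toℕ j)

  -- Columns j ≥ m use xᵢ + 1. Lowering m from p+2 to p+1 adds column p, which is still unshifted,
  -- to column p+1 (Pascal's rule), so the determinant is the same for every m ≥ 1.
  shiftedFrom : ∀ {n} → ℕ → (Fin n → ℕ) → Matrix n
  shiftedFrom m x i j = + ((x i + oneIf≤ m (toℕ j)) C toℕ j)

  shiftedFrom-below : ∀ {n} m (x : Fin n → ℕ) i j → toℕ j < m → shiftedFrom m x i j ≡ binomials x i j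
  shiftedFrom-below m x i j j<m =
    cong (λ y → + (y C toℕ j)) (trans (cong (λ e → x i + e) (oneIf≤-< j<m)) (+-identityʳ (x i)))

  shiftedFrom-1 : ∀ {n} (x : Fin n → ℕ) i j → shiftedFrom 1 x i j ≡ binomials (λ k → suc (x k)) i j
  shiftedFrom-1 x i zero    = refl
  shiftedFrom-1 x i (suc j) = cong (λ y → + (y C suc (toℕ j))) (+-comm (x i) 1)

  det-shiftedFrom-step : ∀ n (x : Fin (suc n) → ℕ) (p : Fin n) →
    det (suc n) (shiftedFrom (suc (toℕ p)) x) ≡ det (suc n) (shiftedFrom (suc (suc (toℕ p))) x)
  det-shiftedFrom-step n x p = det-add-previous-column n 1ℤ p A B B≡A B[p+1]≡A[p+1]+A[p]
    where
    A B : Matrix (suc n)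
    A = shiftedFrom (suc (suc (toℕ p))) x
    B = shiftedFrom (suc (toℕ p)) x
    B≡A : ∀ i j → j ≢ suc p → B i j ≡ A i j
    B≡A i j j≢p+1 = cong (λ e → + ((x i + e) C toℕ j))
      (sym (oneIf≤-≢ (suc (toℕ p)) (toℕ j) (λ eq → j≢p+1 (toℕ-injective eq))))
    A[p]≡ : ∀ i → A i (inject₁ p) ≡ + (x i C toℕ p)
    A[p]≡ i = trans
      (shiftedFrom-below _ x i (inject₁ p)
        (subst (_< suc (suc (toℕ p))) (sym (toℕ-inject₁ p)) (m<n⇒m<1+n (n<1+n (toℕ p)))))
      (cong (λ k → + (x i C k)) (toℕ-inject₁ p))
    B[p+1]≡A[p+1]+A[p] : ∀ i → B i (suc p) ≡ A i (suc p) ℤ.+ 1ℤ ℤ.* A i (inject₁ p)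
    B[p+1]≡A[p+1]+A[p] i = begin
      + ((x i + oneIf≤ (toℕ p) (toℕ p)) C suc (toℕ p))
        ≡⟨ cong (λ e → + ((x i + e) C suc (toℕ p))) (oneIf≤-refl (toℕ p)) ⟩
      + ((x i + 1) C suc (toℕ p))
        ≡⟨ cong (λ y → + (y C suc (toℕ p))) (+-comm (x i) 1) ⟩
      + (suc (x i) C suc (toℕ p))
        ≡⟨ cong +_ (nCk+nC[k+1]≡[n+1]C[k+1] (x i) (toℕ p)) ⟨
      + (x i C toℕ p + x i C suc (toℕ p))
        ≡⟨ cong +_ (+-comm (x i C toℕ p) (x i C suc (toℕ p))) ⟩
      + (x i C suc (toℕ p) + x i C toℕ p)
        ≡⟨ ℤ.pos-+ (x i C suc (toℕ p)) (x i C toℕ p) ⟩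
      + (x i C suc (toℕ p)) ℤ.+ + (x i C toℕ p)
        ≡⟨ cong₂ ℤ._+_ (shiftedFrom-below _ x i (suc p) (n<1+n (suc (toℕ p)))) (A[p]≡ i) ⟨
      A i (suc p) ℤ.+ A i (inject₁ p)
        ≡⟨ cong (λ z → A i (suc p) ℤ.+ z) (ℤ.*-identityˡ (A i (inject₁ p))) ⟨
      A i (suc p) ℤ.+ 1ℤ ℤ.* A i (inject₁ p) ∎

  det-shiftedFrom-invariant : ∀ n (x : Fin (suc n) → ℕ) m → m ≤ n →
    det (suc n) (shiftedFrom 1 x) ≡ det (suc n) (shiftedFrom (suc m) x)
  det-shiftedFrom-invariant n x zero    m≤n = refl
  det-shiftedFrom-invariant n x (suc m) m<n = begin
    det (suc n) (shiftedFrom 1 x)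
      ≡⟨ det-shiftedFrom-invariant n x m (<⇒≤ m<n) ⟩
    det (suc n) (shiftedFrom (suc m) x)
      ≡⟨ cong (λ k → det (suc n) (shiftedFrom (suc k) x)) (toℕ-fromℕ< m<n) ⟨
    det (suc n) (shiftedFrom (suc (toℕ (fromℕ< m<n))) x)
      ≡⟨ det-shiftedFrom-step n x (fromℕ< m<n) ⟩
    det (suc n) (shiftedFrom (suc (suc (toℕ (fromℕ< m<n)))) x)
      ≡⟨ cong (λ k → det (suc n) (shiftedFrom (suc (suc k)) x)) (toℕ-fromℕ< m<n) ⟩
    det (suc n) (shiftedFrom (suc (suc m)) x) ∎

  det-binomials-suc : ∀ n (x : Fin n → ℕ) → det n (binomials x) ≡ det n (binomials (λ i → suc (x i)))
  det-binomials-suc zero    x = refl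
  det-binomials-suc (suc n) x = begin
    det (suc n) (binomials x)
      ≡⟨ det-cong (suc n) (λ i j → shiftedFrom-below (suc n) x i j (toℕ<n j)) ⟨
    det (suc n) (shiftedFrom (suc n) x)
      ≡⟨ det-shiftedFrom-invariant n x n ≤-refl ⟨
    det (suc n) (shiftedFrom 1 x)
      ≡⟨ det-cong (suc n) (shiftedFrom-1 x) ⟩
    det (suc n) (binomials (λ i → suc (x i))) ∎

  det-binomials-+ : ∀ n (x : Fin n → ℕ) c → det n (binomials (λ i → x i + c)) ≡ det n (binomials x)
  det-binomials-+ n x zero    = det-cong n (λ i j → cong (λ y → + (y C toℕ j)) (+-identityʳ (x i)))
  det-binomials-+ n x (suc c) = begin
    det n (binomials (λ i → x i + suc c))
      ≡⟨ det-cong n (λ i j → cong (λ y → + (y C toℕ j)) (+-suc (x i) c)) ⟩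
    det n (binomials (λ i → suc (x i + c)))
      ≡⟨ det-binomials-suc n (λ i → x i + c) ⟨
    det n (binomials (λ i → x i + c))
      ≡⟨ det-binomials-+ n x c ⟩
    det n (binomials x) ∎

  det-binomials-offset : ∀ n s (x : Fin n → ℕ) →
    ∏ n (λ j → + ((toℕ j + s) C s)) ℤ.* det n (λ i j → + (x i C (toℕ j + s)))
      ≡ ∏ n (λ i → + (x i C s)) ℤ.* det n (binomials (λ i → x i ∸ s))
  det-binomials-offset n s x = begin
    ∏ n (λ j → + ((toℕ j + s) C s)) ℤ.* det n (λ i j → + (x i C (toℕ j + s)))
      ≡⟨ det-scaleColumns n (λ j → + ((toℕ j + s) C s)) (λ i j → + (x i C (toℕ j + s))) ⟨
    det n (λ i j → + (x i C (toℕ j + s)) ℤ.* + ((toℕ j + s) C s))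
      ≡⟨ det-cong n entries ⟩
    det n (λ i j → + (x i C s) ℤ.* binomials (λ k → x k ∸ s) i j)
      ≡⟨ det-scaleRows n (λ i → + (x i C s)) (binomials (λ i → x i ∸ s)) ⟩
    ∏ n (λ i → + (x i C s)) ℤ.* det n (binomials (λ i → x i ∸ s)) ∎
    where
    entries : ∀ i j → + (x i C (toℕ j + s)) ℤ.* + ((toℕ j + s) C s)
                    ≡ + (x i C s) ℤ.* + ((x i ∸ s) C toℕ j)
    entries i j = begin
      + (x i C (toℕ j + s)) ℤ.* + ((toℕ j + s) C s)
        ≡⟨ ℤ.pos-* (x i C (toℕ j + s)) ((toℕ j + s) C s) ⟨
      + ((x i C (toℕ j + s)) * ((toℕ j + s) C s))
        ≡⟨ cong +_ (xC[j+s]*[j+s]Cs≡xCs*[x∸s]Cj (x i) s (toℕ j)) ⟩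
      + ((x i C s) * ((x i ∸ s) C toℕ j))
        ≡⟨ ℤ.pos-* (x i C s) ((x i ∸ s) C toℕ j) ⟩
      + (x i C s) ℤ.* + ((x i ∸ s) C toℕ j) ∎

  ∏-const : ∀ n k → ∏ n (λ _ → + k) ≡ + (k ^ n)
  ∏-const zero    k = refl
  ∏-const (suc n) k = trans (cong (+ k ℤ.*_) (∏-const n k)) (sym (ℤ.pos-* k (k ^ n)))

  evens : ∀ {n} → Fin n → ℕ
  evens i = 2 * toℕ i

  det-binomials-evens-suc : ∀ n → det (suc n) (binomials evens) ≡ + (2 ^ n) ℤ.* det n (binomials evens)
  det-binomials-evens-suc n = begin
    det (suc n) (binomials evens)   ≡⟨ det-firstRow-sparse n (binomials evens) (λ j → refl) ⟩
    1ℤ ℤ.* E                        ≡⟨ ℤ.*-identityˡ E ⟩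
    E                               ≡⟨ ℤ.*-cancelˡ-≡ F E (+ (2 ^ n) ℤ.* G) {{F≢0}} F*E≡F*2ⁿ*G ⟩
    + (2 ^ n) ℤ.* G                 ∎
    where
    x : Fin n → ℕ
    x i = 2 * suc (toℕ i)
    E G F : ℤ
    E = det n (λ i j → + (x i C suc (toℕ j)))
    G = det n (binomials evens)
    F = ∏ n (λ j → + suc (toℕ j))
    F≢0 : ℤ.NonZero F
    F≢0 = ∏-nonZero n (λ j → + suc (toℕ j)) (λ j → _)
    F*E≡F*2ⁿ*G : F ℤ.* E ≡ F ℤ.* (+ (2 ^ n) ℤ.* G)
    F*E≡F*2ⁿ*G = begin
      F ℤ.* E
        ≡⟨ cong₂ ℤ._*_ (∏-cong {n} (λ j → cong +_ (trans (nC1≡n (toℕ j + 1)) (+-comm (toℕ j) 1))))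
                       (det-cong n (λ i j → cong (λ k → + (x i C k)) (+-comm (toℕ j) 1))) ⟨
      ∏ n (λ j → + ((toℕ j + 1) C 1)) ℤ.* det n (λ i j → + (x i C (toℕ j + 1)))
        ≡⟨ det-binomials-offset n 1 x ⟩
      ∏ n (λ i → + (x i C 1)) ℤ.* det n (binomials (λ i → x i ∸ 1))
        ≡⟨ cong₂ ℤ._*_ (∏-cong {n} (λ i → trans (cong +_ (nC1≡n (x i))) (ℤ.pos-* 2 (suc (toℕ i)))))
             (det-cong n (λ i j → cong (λ y → + (y C toℕ j)) (+-suc (toℕ i) (toℕ i + 0)))) ⟩
      ∏ n (λ i → + 2 ℤ.* + suc (toℕ i)) ℤ.* det n (binomials (λ i → suc (evens i)))
        ≡⟨ cong₂ ℤ._*_ (∏-distrib-* {n} (λ _ → + 2) (λ i → + suc (toℕ i)))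
                       (sym (det-binomials-suc n evens)) ⟩
      (∏ n (λ _ → + 2) ℤ.* F) ℤ.* G
        ≡⟨ cong (λ z → (z ℤ.* F) ℤ.* G) (∏-const n 2) ⟩
      (+ (2 ^ n) ℤ.* F) ℤ.* G
        ≡⟨ cong (ℤ._* G) (ℤ.*-comm (+ (2 ^ n)) F) ⟩
      (F ℤ.* + (2 ^ n)) ℤ.* G
        ≡⟨ ℤ.*-assoc F (+ (2 ^ n)) G ⟩
      F ℤ.* (+ (2 ^ n) ℤ.* G) ∎

  det-binomials-evens : ∀ n → det n (binomials evens) ≡ + (2 ^ (n C 2))
  det-binomials-evens zero    = refl
  det-binomials-evens (suc n) = begin
    det (suc n) (binomials evens)          ≡⟨ det-binomials-evens-suc n ⟩
    + (2 ^ n) ℤ.* det n (binomials evens)  ≡⟨ cong (+ (2 ^ n) ℤ.*_) (det-binomials-evens n) ⟩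
    + (2 ^ n) ℤ.* + (2 ^ (n C 2))          ≡⟨ ℤ.pos-* (2 ^ n) (2 ^ (n C 2)) ⟨
    + (2 ^ n * 2 ^ (n C 2))                ≡⟨ cong +_ (^-distribˡ-+-* 2 n (n C 2)) ⟨
    + (2 ^ (n + n C 2))                    ≡⟨ cong (λ e → + (2 ^ (e + n C 2))) (nC1≡n n) ⟨
    + (2 ^ (n C 1 + n C 2))                ≡⟨ cong (λ e → + (2 ^ e)) (nCk+nC[k+1]≡[n+1]C[k+1] n 1) ⟩
    + (2 ^ (suc n C 2))                    ∎

  ∏C[j+b,b]*det≡∏C[2i+2a,b]*2^[nC2] : ∀ a b n → 1 ≤ n →
    ∏ n (λ j → + ((toℕ j + b) C b)) ℤ.* det n (λ i j → + ((2 * toℕ i + 2 * a) C (toℕ j + b)))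
      ≡ ∏ n (λ i → + ((2 * toℕ i + 2 * a) C b)) ℤ.* + (2 ^ (n C 2))
  ∏C[j+b,b]*det≡∏C[2i+2a,b]*2^[nC2] a b n 1≤n =
    trans (det-binomials-offset n b x) (cases (b ≤? 2 * a) n 1≤n)
    where
    x : ∀ {n} → Fin n → ℕ
    x i = 2 * toℕ i + 2 * a
    cases : Dec (b ≤ 2 * a) → ∀ n → 1 ≤ n →
      ∏ n (λ i → + (x i C b)) ℤ.* det n (binomials (λ i → x i ∸ b))
        ≡ ∏ n (λ i → + (x i C b)) ℤ.* + (2 ^ (n C 2))
    cases (yes b≤2a) n _ = cong (∏ n (λ i → + (x i C b)) ℤ.*_) (begin
      det n (binomials (λ i → x i ∸ b))
        ≡⟨ det-cong n (λ i j → cong (λ y → + (y C toℕ j)) (+-∸-assoc (2 * toℕ i) b≤2a)) ⟩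
      det n (binomials (λ i → evens i + (2 * a ∸ b)))
        ≡⟨ det-binomials-+ n evens (2 * a ∸ b) ⟩
      det n (binomials evens)
        ≡⟨ det-binomials-evens n ⟩
      + (2 ^ (n C 2)) ∎)
    cases (no b≰2a) (suc n) _ = begin
      ∏ (suc n) (λ i → + (x i C b)) ℤ.* det (suc n) (binomials (λ i → x i ∸ b))
        ≡⟨ cong (ℤ._* det (suc n) (binomials (λ i → x i ∸ b))) ∏≡0 ⟩
      0ℤ
        ≡⟨ cong (ℤ._* + (2 ^ (suc n C 2))) ∏≡0 ⟨
      ∏ (suc n) (λ i → + (x i C b)) ℤ.* + (2 ^ (suc n C 2)) ∎
      where
      ∏≡0 : ∏ (suc n) (λ i → + (x i C b)) ≡ 0ℤ
      ∏≡0 = cong (λ y → + y ℤ.* ∏ n (λ i → + (x (suc i) C b))) (k>n⇒nCk≡0 (≰⇒> b≰2a))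

open import Data.Nat using (ℕ; _+_; _*_; _^_; _≤_)
open import Data.Nat.Combinatorics using (_C_)
open import Data.Fin using (toℕ)
open import Data.Integer using (+_)
open import Data.Rational using (ℚ; _/_)
import Data.Rational as ℚ

open import Data.Nat using (zero; suc; NonZero)
open import Data.Fin using (fromℕ)
open import Data.Fin.Properties using (toℕ-fromℕ)
open import Data.Nat.Coprimality using (1-coprimeTo) renaming (sym to coprime-sym)
open import Data.Integer using (ℤ)
import Data.Integer as ℤ
open import Data.Rational using (mkℚ; 1ℚ)
import Data.Rational.Properties as ℚ
open import Algebra.Bundles using (CommutativeMonoid)
open import Algebra.Properties.CommutativeSemigroup
  (CommutativeMonoid.commutativeSemigroup ℚ.*-1-commutativeMonoid) using (x∙yz≈z∙yx)
open import Algebra.Properties.CommutativeMonoid.Sum ℚ.*-1-commutativeMonoid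
  using () renaming (sum to productℚ; sum-cong-≗ to ∏ℚ-cong; sum-init-last to ∏ℚ-init-last;
                     ∑-distrib-+ to ∏ℚ-distrib-*; sum-replicate-zero to ∏ℚ-replicate-1)
open Determinant using (∏)
open BinomialDeterminant using (∏C[j+b,b]*det≡∏C[2i+2a,b]*2^[nC2])
open ≡-Reasoning

∏ℚ : ∀ n → (Fin n → ℚ) → ℚ
∏ℚ n = productℚ

-- With denominator 1 written as mkℚ, ℚ's _*_ computes (i ℤ.* j) / (1 * 1).
i/1≡mkℚ : ∀ i → i / 1 ≡ mkℚ i 0 (coprime-sym (1-coprimeTo ℤ.∣ i ∣))
i/1≡mkℚ i = ℚ.↥p/↧p≡p (mkℚ i 0 (coprime-sym (1-coprimeTo ℤ.∣ i ∣)))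

/1-homo-* : ∀ i j → (i ℤ.* j) / 1 ≡ (i / 1) ℚ.* (j / 1)
/1-homo-* i j = sym (cong₂ ℚ._*_ (i/1≡mkℚ i) (i/1≡mkℚ j))

1/k*k≡1 : ∀ k .{{_ : NonZero k}} → ((+ 1) / k) ℚ.* ((+ k) / 1) ≡ 1ℚ
1/k*k≡1 (suc k) =
  trans (cong₂ ℚ._*_ (ℚ.↥p/↧p≡p (ℚ.1/ k+1)) (i/1≡mkℚ (+ suc k))) (ℚ.*-inverseˡ k+1)
  where
  k+1 : ℚ
  k+1 = mkℚ (+ suc k) 0 (coprime-sym (1-coprimeTo (suc k)))

/1-solve : ∀ (v : ℚ) (p d y : ℤ) → v ℚ.* (p / 1) ≡ 1ℚ → p ℤ.* d ≡ y → d / 1 ≡ v ℚ.* (y / 1)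
/1-solve v p d y v*p≡1 p*d≡y = begin
  d / 1                        ≡⟨ ℚ.*-identityˡ (d / 1) ⟨
  1ℚ ℚ.* (d / 1)               ≡⟨ cong (ℚ._* (d / 1)) v*p≡1 ⟨
  (v ℚ.* (p / 1)) ℚ.* (d / 1)  ≡⟨ ℚ.*-assoc v (p / 1) (d / 1) ⟩
  v ℚ.* ((p / 1) ℚ.* (d / 1))  ≡⟨ cong (v ℚ.*_) (/1-homo-* p d) ⟨
  v ℚ.* ((p ℤ.* d) / 1)        ≡⟨ cong (λ z → v ℚ.* (z / 1)) p*d≡y ⟩
  v ℚ.* (y / 1)                ∎

prodℚ≡∏ℚ : ∀ n (f : ℕ → ℚ) → prodℚ n f ≡ ∏ℚ n (λ j → f (toℕ j))
prodℚ≡∏ℚ zero    f = refl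
prodℚ≡∏ℚ (suc n) f = begin
  prodℚ n f ℚ.* f n
    ≡⟨ cong₂ ℚ._*_ (prodℚ≡∏ℚ n f) (cong f (sym (toℕ-fromℕ n))) ⟩
  ∏ℚ n (λ j → f (toℕ j)) ℚ.* f (toℕ (fromℕ n))
    ≡⟨ cong (ℚ._* f (toℕ (fromℕ n))) (∏ℚ-cong {n} (λ j → cong f (sym (toℕ-inject₁ j)))) ⟩
  ∏ℚ n (λ j → f (toℕ (inject₁ j))) ℚ.* f (toℕ (fromℕ n))
    ≡⟨ ∏ℚ-init-last {n} (λ j → f (toℕ j)) ⟨
  ∏ℚ (suc n) (λ j → f (toℕ j)) ∎

∏ℚ-/1 : ∀ n (g : Fin n → ℤ) → ∏ℚ n (λ j → g j / 1) ≡ ∏ n g / 1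
∏ℚ-/1 zero    g = refl
∏ℚ-/1 (suc n) g = trans (cong (g zero / 1 ℚ.*_) (∏ℚ-/1 n (λ j → g (suc j))))
                        (sym (/1-homo-* (g zero) (∏ n (λ j → g (suc j)))))

prodℚ-/1 : ∀ n (g : ℕ → ℤ) → prodℚ n (λ i → g i / 1) ≡ ∏ n (λ j → g (toℕ j)) / 1
prodℚ-/1 n g = trans (prodℚ≡∏ℚ n (λ i → g i / 1)) (∏ℚ-/1 n (λ j → g (toℕ j)))

prodℚ-distrib-* : ∀ n (f g : ℕ → ℚ) → prodℚ n (λ i → f i ℚ.* g i) ≡ prodℚ n f ℚ.* prodℚ n g
prodℚ-distrib-* n f g = begin
  prodℚ n (λ i → f i ℚ.* g i)
    ≡⟨ prodℚ≡∏ℚ n (λ i → f i ℚ.* g i) ⟩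
  ∏ℚ n (λ j → f (toℕ j) ℚ.* g (toℕ j))
    ≡⟨ ∏ℚ-distrib-* {n} (λ j → f (toℕ j)) (λ j → g (toℕ j)) ⟩
  ∏ℚ n (λ j → f (toℕ j)) ℚ.* ∏ℚ n (λ j → g (toℕ j))
    ≡⟨ cong₂ ℚ._*_ (prodℚ≡∏ℚ n f) (prodℚ≡∏ℚ n g) ⟨
  prodℚ n f ℚ.* prodℚ n g ∎

prodℚ-invBinom*∏≡1 : ∀ n b →
  prodℚ n (λ i → invBinom i b) ℚ.* (∏ n (λ j → + ((toℕ j + b) C b)) / 1) ≡ 1ℚ
prodℚ-invBinom*∏≡1 n b = begin
  prodℚ n (λ i → invBinom i b) ℚ.* (∏ n (λ j → + ((toℕ j + b) C b)) / 1)
    ≡⟨ cong (prodℚ n (λ i → invBinom i b) ℚ.*_) (prodℚ-/1 n (λ i → + ((i + b) C b))) ⟨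
  prodℚ n (λ i → invBinom i b) ℚ.* prodℚ n (λ i → + ((i + b) C b) / 1)
    ≡⟨ prodℚ-distrib-* n (λ i → invBinom i b) (λ i → + ((i + b) C b) / 1) ⟨
  prodℚ n (λ i → invBinom i b ℚ.* (+ ((i + b) C b) / 1))
    ≡⟨ prodℚ≡∏ℚ n (λ i → invBinom i b ℚ.* (+ ((i + b) C b) / 1)) ⟩
  ∏ℚ n (λ j → invBinom (toℕ j) b ℚ.* (+ ((toℕ j + b) C b) / 1))
    ≡⟨ ∏ℚ-cong {n} (λ j → 1/k*k≡1 ((toℕ j + b) C b) {{binom-nonZero (toℕ j) b}}) ⟩
  ∏ℚ n (λ _ → 1ℚ)
    ≡⟨ ∏ℚ-replicate-1 n ⟩
  1ℚ ∎

mainTheorem1 : (a b n : ℕ) → 1 ≤ n →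
    det n (λ i j → + ((2 * toℕ i + 2 * a) C (toℕ j + b))) / 1
      ≡ ℕtoℚ (2 ^ (n C 2))
        ℚ.* prodℚ n (λ i → ℕtoℚ ((2 * i + 2 * a) C b) ℚ.* invBinom i b)
mainTheorem1 a b n 1≤n = begin
  D / 1
    ≡⟨ /1-solve v P D (X ℤ.* e) (prodℚ-invBinom*∏≡1 n b)
                 (∏C[j+b,b]*det≡∏C[2i+2a,b]*2^[nC2] a b n 1≤n) ⟩
  v ℚ.* ((X ℤ.* e) / 1)
    ≡⟨ cong (v ℚ.*_) (/1-homo-* X e) ⟩
  v ℚ.* ((X / 1) ℚ.* (e / 1))
    ≡⟨ x∙yz≈z∙yx v (X / 1) (e / 1) ⟩
  (e / 1) ℚ.* ((X / 1) ℚ.* v)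
    ≡⟨ cong (λ z → (e / 1) ℚ.* (z ℚ.* v)) (prodℚ-/1 n (λ i → + ((2 * i + 2 * a) C b))) ⟨
  (e / 1) ℚ.* (prodℚ n (λ i → ℕtoℚ ((2 * i + 2 * a) C b)) ℚ.* v)
    ≡⟨ cong ((e / 1) ℚ.*_)
            (prodℚ-distrib-* n (λ i → ℕtoℚ ((2 * i + 2 * a) C b)) (λ i → invBinom i b)) ⟨
  ℕtoℚ (2 ^ (n C 2)) ℚ.* prodℚ n (λ i → ℕtoℚ ((2 * i + 2 * a) C b) ℚ.* invBinom i b) ∎
  where
  D P X e : ℤ
  D = det n (λ i j → + ((2 * toℕ i + 2 * a) C (toℕ j + b)))
  P = ∏ n (λ j → + ((toℕ j + b) C b))
  X = ∏ n (λ i → + ((2 * toℕ i + 2 * a) C b))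
  e = + (2 ^ (n C 2))
  v : ℚ
  v = prodℚ n (λ i → invBinom i b)
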